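{- Let $n\ge2$. If $\mathsf u$ is an $e$-subword of $\boldsymbol\lambda_n$, then its rotation $\operatorname{rot}(\mathsf u)$ is also an $e$-subword of $\boldsymbol\lambda_n$.
   Context: $\widetilde S_n$ is the affine symmetric group (bijections $w:\mathbb Z\to\mathbb Z$ with $w(i+n)=w(i)+n$ and $\sum_{i=1}^n w(i)=\binom{n+1}{2}$, multiplied by composition). $s_j$ interchanges $j+kn$ and $j+1+kn$ for all $k$ (index mod $n$). $\boldsymbol\lambda_n$ is the word $[s_0,\dots,s_{n-1}]$ repeated $n-1$ times; its $j$-th letter ($1\le j\le n(n-1)$) is $s_{j-1}$. A subword is $\mathsf u=[u_1,\dots,u_{n(n-1)}]$ with each $u_j$ equal to either the $j$-th letter (a take) or the identity $e$ (a skip); it is an $e$-subword if $u_1u_2\cdots u_{n(n-1)}=e$. The rotation $\operatorname{rot}(\mathsf u)$ is the subword of $\boldsymbol\lambda_n$ whose position $1$ is a skip iff position $n(n-1)$ of $\mathsf u$ is a skip, and whose position $i\ge2$ is a skip iff position $i-1$ of $\mathsf u$ is a skip. -}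

module Defs where

open import Data.Nat using (ℕ; zero; suc; _*_; _∸_; _≡ᵇ_; _%_)
open import Data.Integer using (ℤ; _+_; _-_; 1ℤ)
open import Data.Integer.DivMod using (_%ℕ_)
open import Data.Bool using (Bool; true; false; if_then_else_)
open import Data.Vec using (Vec; []; _∷_; last; init)
open import Function using (id; _∘_)

-- The simple reflection s_j of the affine symmetric group on ℤ (index j taken mod n):
-- it interchanges j + kn and j + 1 + kn for all k, and fixes all other integers.
-- (For n = 0 we return the identity; it is never used since n ≥ 2.)
s : (n : ℕ) → ℕ → ℤ → ℤ
s zero j x = x
s (suc m) j x =
  if (x %ℕ suc m) ≡ᵇ (j % suc m) then x + 1ℤ
  else if (x %ℕ suc m) ≡ᵇ (suc j % suc m) then x - 1ℤ
  else x

-- A subword of λ_n: position p (0-indexed) is true = take the letter s_{p mod n},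
-- false = skip (identity e).  λ_n has length n(n-1).
Subword : ℕ → Set
Subword n = Vec Bool (n * (n ∸ 1))

prodFrom : (n p : ℕ) {m : ℕ} → Vec Bool m → ℤ → ℤ
prodFrom n p [] = id
prodFrom n p (true ∷ bs) = s n p ∘ prodFrom n (suc p) bs
prodFrom n p (false ∷ bs) = prodFrom n (suc p) bs

prod : (n : ℕ) → Subword n → ℤ → ℤ
prod n u = prodFrom n 0 u

IsESubword : (n : ℕ) → Subword n → Set
IsESubword n u = (x : ℤ) → prod n u x ≡ x
  where open import Relation.Binary.PropositionalEquality using (_≡_)

rotV : {m : ℕ} → Vec Bool m → Vec Bool m
rotV {zero} [] = []
rotV {suc m} xs = last xs ∷ init xs

rot : (n : ℕ) → Subword n → Subword n
rot n u = rotV u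

{-# OPTIONS --safe #-}
module Submission where

open import Defs
open import Data.Nat as ℕ using (ℕ; zero; suc; _∸_; _%_; _≡ᵇ_; _≟_; _<_; _≤_; z<s; s≤s; z≤n; NonZero)
open import Data.Nat.Properties
  using (+-comm; +-suc; +-identityʳ; +-∸-assoc; m+n∸n≡m; ∸-monoʳ-<; <⇒≤; <-irrefl; m≤n⇒m<n∨m≡n; 1+n≢n)
open import Data.Nat.DivMod using (%-distribˡ-+; m%n%n≡m%n; [m+n]%n≡m%n; n%n≡0; m%n<n; m<n⇒m%n≡m)
open import Data.Nat.Divisibility using (_∣_; n∣m⇒m%n≡0; m∣m*n)
open import Data.Integer using (ℤ; +_; -[1+_]; -_; 1ℤ; -1ℤ; _+_; _-_; _%ℕ_)
open import Data.Integer.Properties as ℤ using ()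
open import Data.Integer.DivMod using (n%ℕd<d)
open import Data.Bool using (Bool; true; false; if_then_else_)
open import Data.Vec using (Vec; []; _∷_; _∷ʳ_; init; last; initLast)
open import Data.Product using (proj₂)
open import Data.Sum using (inj₁; inj₂)
open import Function using (id; _∘_)
open import Relation.Nullary using (yes; no)
open import Relation.Nullary.Decidable using (dec-true; dec-false)
open import Relation.Binary.PropositionalEquality

-- Conjugating by the translation τ x = x + 1 shifts indices: τ s_j τ⁻¹ = s_{j+1}.
-- Write u = w t, where t is the last factor (s_{L-1} or e, L = n(n-1)).  Since the
-- s_j are involutions, u = e forces the product of w to be t.  The rotation is
-- t′ (τ w τ⁻¹) = t′ (τ t τ⁻¹), where t′ is s_0 or e accordingly, and τ t τ⁻¹ is s_L or e;
-- as n divides L, s_L = s_0, so the product is t′ t′ = e.  Involutivity needs n ≥ 2: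
-- for n = 1 every s_j is the translation τ.

≡ᵇ-true : ∀ {a b} → a ≡ b → (a ≡ᵇ b) ≡ true
≡ᵇ-true = dec-true (_ ≟ _)

≡ᵇ-false : ∀ {a b} → a ≢ b → (a ≡ᵇ b) ≡ false
≡ᵇ-false = dec-false (_ ≟ _)

[m+n%d]%d≡[m+n]%d : ∀ m n d .{{_ : NonZero d}} → (m ℕ.+ n % d) % d ≡ (m ℕ.+ n) % d
[m+n%d]%d≡[m+n]%d m n d = begin
  (m ℕ.+ n % d) % d          ≡⟨ %-distribˡ-+ m (n % d) d ⟩
  (m % d ℕ.+ n % d % d) % d  ≡⟨ cong (λ r → (m % d ℕ.+ r) % d) (m%n%n≡m%n n d) ⟩
  (m % d ℕ.+ n % d) % d      ≡⟨ %-distribˡ-+ m n d ⟨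
  (m ℕ.+ n) % d              ∎
  where open ≡-Reasoning

i+1-1≡i : ∀ i → i + 1ℤ - 1ℤ ≡ i
i+1-1≡i i = trans (ℤ.+-assoc i 1ℤ -1ℤ) (ℤ.+-identityʳ i)

i-1+1≡i : ∀ i → i - 1ℤ + 1ℤ ≡ i
i-1+1≡i i = trans (ℤ.+-assoc i -1ℤ 1ℤ) (ℤ.+-identityʳ i)

-[1+]+1≡- : ∀ a → -[1+ a ] + 1ℤ ≡ - + a
-[1+]+1≡- zero    = refl
-[1+]+1≡- (suc a) = refl

left-inverse-of-involution : ∀ {A : Set} {f g : A → A} →
                             (∀ x → f (f x) ≡ x) → (∀ x → g (f x) ≡ x) → g ≗ f
left-inverse-of-involution {f = f} {g} f-involutive g∘f≗id x =
  trans (cong g (sym (f-involutive x))) (g∘f≗id (f x))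

shift-conjugate-cong : ∀ {f f′ g g′ : ℤ → ℤ} →
                       (∀ x → g (x + 1ℤ) ≡ f x + 1ℤ) → (∀ x → g′ (x + 1ℤ) ≡ f′ x + 1ℤ) →
                       f ≗ f′ → g ≗ g′
shift-conjugate-cong {f} {f′} {g} {g′} g-shift g′-shift f≗f′ x = begin
  g x                  ≡⟨ cong g (i-1+1≡i x) ⟨
  g (x - 1ℤ + 1ℤ)      ≡⟨ g-shift (x - 1ℤ) ⟩
  f (x - 1ℤ) + 1ℤ      ≡⟨ cong (_+ 1ℤ) (f≗f′ (x - 1ℤ)) ⟩
  f′ (x - 1ℤ) + 1ℤ     ≡⟨ g′-shift (x - 1ℤ) ⟨
  g′ (x - 1ℤ + 1ℤ)     ≡⟨ cong g′ (i-1+1≡i x) ⟩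
  g′ x                 ∎
  where open ≡-Reasoning

factor : ℕ → ℕ → Bool → ℤ → ℤ
factor n p true  = s n p
factor n p false = id

prodFrom-∷ : ∀ n p b {l} (bs : Vec Bool l) → prodFrom n p (b ∷ bs) ≗ factor n p b ∘ prodFrom n (suc p) bs
prodFrom-∷ n p true  bs x = refl
prodFrom-∷ n p false bs x = refl

prodFrom-∷ʳ : ∀ n p {l} (bs : Vec Bool l) b → prodFrom n p (bs ∷ʳ b) ≗ prodFrom n p bs ∘ factor n (p ℕ.+ l) b
prodFrom-∷ʳ n p [] b x = trans (prodFrom-∷ n p b [] x) (cong (λ q → factor n q b x) (sym (+-identityʳ p)))
prodFrom-∷ʳ n p {suc l} (true ∷ bs) b x rewrite +-suc p l = cong (s n p) (prodFrom-∷ʳ n (suc p) bs b x)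
prodFrom-∷ʳ n p {suc l} (false ∷ bs) b x rewrite +-suc p l = prodFrom-∷ʳ n (suc p) bs b x

module _ (m : ℕ) where

  private
    n : ℕ
    n = suc m

  sucMod : ℕ → ℕ
  sucMod r = suc r % n

  predMod : ℕ → ℕ
  predMod r = (m ℕ.+ r) % n

  %-suc : ∀ j → suc j % n ≡ sucMod (j % n)
  %-suc j = sym ([m+n%d]%d≡[m+n]%d 1 j n)

  predMod-sucMod : ∀ r → predMod (sucMod r) ≡ r % n
  predMod-sucMod r = begin
    (m ℕ.+ suc r % n) % n  ≡⟨ [m+n%d]%d≡[m+n]%d m (suc r) n ⟩
    (m ℕ.+ suc r) % n      ≡⟨ cong (_% n) (trans (+-comm m (suc r)) (sym (+-suc r m))) ⟩
    (r ℕ.+ n) % n          ≡⟨ [m+n]%n≡m%n r n ⟩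
    r % n                  ∎
    where open ≡-Reasoning

  sucMod-injective : ∀ {r r′} → r < n → r′ < n → sucMod r ≡ sucMod r′ → r ≡ r′
  sucMod-injective {r} {r′} r<n r′<n eq = begin
    r                    ≡⟨ m<n⇒m%n≡m r<n ⟨
    r % n                ≡⟨ predMod-sucMod r ⟨
    predMod (sucMod r)   ≡⟨ cong predMod eq ⟩
    predMod (sucMod r′)  ≡⟨ predMod-sucMod r′ ⟩
    r′ % n               ≡⟨ m<n⇒m%n≡m r′<n ⟩
    r′                   ∎
    where open ≡-Reasoning

  sucMod-≢ : 1 < n → ∀ {r} → r < n → sucMod r ≢ r
  sucMod-≢ 1<n r<n with m≤n⇒m<n∨m≡n r<n
  ... | inj₁ 1+r<n = λ eq → 1+n≢n (trans (sym (m<n⇒m%n≡m 1+r<n)) eq)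
  ... | inj₂ refl  = λ eq → <-irrefl (cong suc (trans (sym (n%n≡0 n)) eq)) 1<n

  -- (n ∸ r) % n rather than n ∸ r, so that the residue 0 is sent to 0.
  neg-%ℕ : ∀ a → (- + a) %ℕ n ≡ (n ∸ a % n) % n
  neg-%ℕ zero = sym (n%n≡0 n)
  neg-%ℕ (suc a) with suc a % n | m%n<n (suc a) n
  ... | zero  | _     = sym (n%n≡0 n)
  ... | suc r | 1+r<n = sym (m<n⇒m%n≡m (∸-monoʳ-< z<s (<⇒≤ 1+r<n)))

  suc-n∸sucMod : ∀ {r} → r < n → suc (n ∸ sucMod r) % n ≡ (n ∸ r) % n
  suc-n∸sucMod {r} r<n with m≤n⇒m<n∨m≡n r<n
  ... | inj₁ 1+r<n rewrite m<n⇒m%n≡m 1+r<n = cong (_% n) (sym (+-∸-assoc 1 r<n))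
  ... | inj₂ refl  = begin
    suc (n ∸ sucMod m) % n  ≡⟨ cong (λ t → suc (n ∸ t) % n) (n%n≡0 n) ⟩
    suc n % n               ≡⟨ [m+n]%n≡m%n 1 n ⟩
    1 % n                   ≡⟨ cong (_% n) (m+n∸n≡m 1 m) ⟨
    (n ∸ m) % n             ∎
    where open ≡-Reasoning

  %ℕ-+1 : ∀ x → (x + 1ℤ) %ℕ n ≡ sucMod (x %ℕ n)
  %ℕ-+1 (+ a)    = trans (cong (_% n) (+-comm a 1)) (%-suc a)
  %ℕ-+1 -[1+ a ] = begin
    (-[1+ a ] + 1ℤ) %ℕ n          ≡⟨ cong (_%ℕ n) (-[1+]+1≡- a) ⟩
    (- + a) %ℕ n                  ≡⟨ neg-%ℕ a ⟩
    (n ∸ a % n) % n               ≡⟨ suc-n∸sucMod (m%n<n a n) ⟨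
    suc (n ∸ sucMod (a % n)) % n  ≡⟨ cong (λ r → suc (n ∸ r) % n) (%-suc a) ⟨
    suc (n ∸ suc a % n) % n       ≡⟨ %-suc (n ∸ suc a % n) ⟩
    sucMod ((n ∸ suc a % n) % n)  ≡⟨ cong sucMod (neg-%ℕ (suc a)) ⟨
    sucMod (-[1+ a ] %ℕ n)        ∎
    where open ≡-Reasoning

  %ℕ-+1-≡ : ∀ x {a} → x %ℕ n ≡ a → (x + 1ℤ) %ℕ n ≡ sucMod a
  %ℕ-+1-≡ x eq = trans (%ℕ-+1 x) (cong sucMod eq)

  %ℕ-+1-≢ : ∀ x {a} → a < n → x %ℕ n ≢ a → (x + 1ℤ) %ℕ n ≢ sucMod a
  %ℕ-+1-≢ x a<n ne eq = ne (sucMod-injective (n%ℕd<d x n) a<n (trans (sym (%ℕ-+1 x)) eq))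

  reflect : ℕ → ℤ → ℤ
  reflect a x = if x %ℕ n ≡ᵇ a then x + 1ℤ else if x %ℕ n ≡ᵇ sucMod a then x - 1ℤ else x

  s≗reflect : ∀ j → s n j ≗ reflect (j % n)
  s≗reflect j x rewrite %-suc j = refl

  reflect-up : ∀ {a} x → x %ℕ n ≡ a → reflect a x ≡ x + 1ℤ
  reflect-up _ eq rewrite ≡ᵇ-true eq = refl

  reflect-down : ∀ {a} x → x %ℕ n ≢ a → x %ℕ n ≡ sucMod a → reflect a x ≡ x - 1ℤ
  reflect-down _ ne eq rewrite ≡ᵇ-false ne | ≡ᵇ-true eq = refl

  reflect-fix : ∀ {a} x → x %ℕ n ≢ a → x %ℕ n ≢ sucMod a → reflect a x ≡ x
  reflect-fix _ ne ne′ rewrite ≡ᵇ-false ne | ≡ᵇ-false ne′ = refl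

  reflect-shift : ∀ {a} → a < n → ∀ x → reflect (sucMod a) (x + 1ℤ) ≡ reflect a x + 1ℤ
  reflect-shift {a} a<n x with x %ℕ n ≟ a | x %ℕ n ≟ sucMod a
  ... | yes eq | _ =
    trans (reflect-up (x + 1ℤ) (%ℕ-+1-≡ x eq)) (cong (_+ 1ℤ) (sym (reflect-up x eq)))
  ... | no ne | yes eq = begin
    reflect (sucMod a) (x + 1ℤ)  ≡⟨ reflect-down (x + 1ℤ) (%ℕ-+1-≢ x a<n ne) (%ℕ-+1-≡ x eq) ⟩
    x + 1ℤ - 1ℤ                  ≡⟨ i+1-1≡i x ⟩
    x                            ≡⟨ i-1+1≡i x ⟨
    x - 1ℤ + 1ℤ                  ≡⟨ cong (_+ 1ℤ) (reflect-down x ne eq) ⟨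
    reflect a x + 1ℤ             ∎
    where open ≡-Reasoning
  ... | no ne | no ne′ =
    trans (reflect-fix (x + 1ℤ) (%ℕ-+1-≢ x a<n ne) (%ℕ-+1-≢ x (m%n<n (suc a) n) ne′))
          (cong (_+ 1ℤ) (sym (reflect-fix x ne ne′)))

  reflect-involutive : 1 < n → ∀ {a} → a < n → ∀ x → reflect a (reflect a x) ≡ x
  reflect-involutive 1<n {a} a<n x with x %ℕ n ≟ a | x %ℕ n ≟ sucMod a
  ... | yes eq | _ = begin
    reflect a (reflect a x)  ≡⟨ cong (reflect a) (reflect-up x eq) ⟩
    reflect a (x + 1ℤ)       ≡⟨ reflect-down (x + 1ℤ) (sucMod-≢ 1<n a<n ∘ trans (sym (%ℕ-+1-≡ x eq)))
                                                     (%ℕ-+1-≡ x eq) ⟩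
    x + 1ℤ - 1ℤ              ≡⟨ i+1-1≡i x ⟩
    x                        ∎
    where open ≡-Reasoning
  ... | no ne | yes eq = begin
    reflect a (reflect a x)  ≡⟨ cong (reflect a) (reflect-down x ne eq) ⟩
    reflect a (x - 1ℤ)       ≡⟨ reflect-up (x - 1ℤ) x-1≡a ⟩
    x - 1ℤ + 1ℤ              ≡⟨ i-1+1≡i x ⟩
    x                        ∎
    where
    open ≡-Reasoning
    x-1≡a : (x - 1ℤ) %ℕ n ≡ a
    x-1≡a = sucMod-injective (n%ℕd<d (x - 1ℤ) n) a<n
              (trans (sym (%ℕ-+1 (x - 1ℤ))) (trans (cong (_%ℕ n) (i-1+1≡i x)) eq))
  ... | no ne | no ne′ = trans (cong (reflect a) (reflect-fix x ne ne′)) (reflect-fix x ne ne′)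

  s-shift : ∀ j x → s n (suc j) (x + 1ℤ) ≡ s n j x + 1ℤ
  s-shift j x = begin
    s n (suc j) (x + 1ℤ)               ≡⟨ s≗reflect (suc j) (x + 1ℤ) ⟩
    reflect (suc j % n) (x + 1ℤ)       ≡⟨ cong (λ a → reflect a (x + 1ℤ)) (%-suc j) ⟩
    reflect (sucMod (j % n)) (x + 1ℤ)  ≡⟨ reflect-shift (m%n<n j n) x ⟩
    reflect (j % n) x + 1ℤ             ≡⟨ cong (_+ 1ℤ) (s≗reflect j x) ⟨
    s n j x + 1ℤ                       ∎
    where open ≡-Reasoning

  s-involutive : 1 < n → ∀ j x → s n j (s n j x) ≡ x
  s-involutive 1<n j x = begin
    s n j (s n j x)                      ≡⟨ s≗reflect j (s n j x) ⟩
    reflect (j % n) (s n j x)            ≡⟨ cong (reflect (j % n)) (s≗reflect j x) ⟩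
    reflect (j % n) (reflect (j % n) x)  ≡⟨ reflect-involutive 1<n (m%n<n j n) x ⟩
    x                                    ∎
    where open ≡-Reasoning

  s-periodic : ∀ {j} → n ∣ j → s n j ≗ s n 0
  s-periodic {j} n∣j x = begin
    s n j x            ≡⟨ s≗reflect j x ⟩
    reflect (j % n) x  ≡⟨ cong (λ a → reflect a x) (n∣m⇒m%n≡0 j n n∣j) ⟩
    reflect 0 x        ≡⟨ s≗reflect 0 x ⟨
    s n 0 x            ∎
    where open ≡-Reasoning

  factor-shift : ∀ p b x → factor n (suc p) b (x + 1ℤ) ≡ factor n p b x + 1ℤ
  factor-shift p true    = s-shift p
  factor-shift p false x = refl

  factor-involutive : 1 < n → ∀ p b x → factor n p b (factor n p b x) ≡ x
  factor-involutive 1<n p true    = s-involutive 1<n p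
  factor-involutive 1<n p false x = refl

  factor-periodic : ∀ {p} → n ∣ p → ∀ b → factor n p b ≗ factor n 0 b
  factor-periodic n∣p true    = s-periodic n∣p
  factor-periodic n∣p false x = refl

  prodFrom-shift : ∀ p {l} (bs : Vec Bool l) x → prodFrom n (suc p) bs (x + 1ℤ) ≡ prodFrom n p bs x + 1ℤ
  prodFrom-shift p []           x = refl
  prodFrom-shift p (true ∷ bs)  x =
    trans (cong (s n (suc p)) (prodFrom-shift (suc p) bs x)) (s-shift p (prodFrom n (suc p) bs x))
  prodFrom-shift p (false ∷ bs) x = prodFrom-shift (suc p) bs x

  rotation-preserves-identity : 1 < n → ∀ {l} → n ∣ suc l → (w : Vec Bool l) (b : Bool) →
                                prodFrom n 0 (w ∷ʳ b) ≗ id → prodFrom n 0 (b ∷ w) ≗ id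
  rotation-preserves-identity 1<n {l} n∣1+l w b w∷ʳb≗id x = begin
    prodFrom n 0 (b ∷ w) x           ≡⟨ prodFrom-∷ n 0 b w x ⟩
    factor n 0 b (prodFrom n 1 w x)  ≡⟨ cong (factor n 0 b) (shifted-w≗first x) ⟩
    factor n 0 b (factor n 0 b x)    ≡⟨ factor-involutive 1<n 0 b x ⟩
    x                                ∎
    where
    open ≡-Reasoning
    w≗last : prodFrom n 0 w ≗ factor n l b
    w≗last = left-inverse-of-involution (factor-involutive 1<n l b)
               (λ y → trans (sym (prodFrom-∷ʳ n 0 w b y)) (w∷ʳb≗id y))
    shifted-w≗first : prodFrom n 1 w ≗ factor n 0 b
    shifted-w≗first y =
      trans (shift-conjugate-cong (prodFrom-shift 0 w) (factor-shift l b) w≗last y) (factor-periodic n∣1+l b y)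

lemma5p6 : (n : ℕ) → 2 ≤ n → (u : Subword n) → IsESubword n u → IsESubword n (rot n u)
lemma5p6 n 2≤n@(s≤s (s≤s z≤n)) u u≗id =
  rotation-preserves-identity (n ∸ 1) 2≤n (m∣m*n (n ∸ 1)) (init u) (last u)
    (λ x → subst (λ v → prod n v x ≡ x) u≡init∷ʳlast (u≗id x))
  where
  u≡init∷ʳlast : u ≡ init u ∷ʳ last u
  u≡init∷ʳlast = proj₂ (proj₂ (initLast u))
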